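{- If $\varphi(\mathbf{x})$ is a CNF formula not containing the empty clause, then the satisfying assignments of $\mathrm{DR}(\varphi)$ are exactly the characteristic functions (on the meta-variables) of the partial assignments $\alpha$ of $\mathbf{x}$ satisfying $\mathrm{cl}_{\mathrm{up}}(\varphi,\alpha)=\alpha$.
   Context: A partial assignment $\alpha$ of $\mathbf{x}$ is a set of literals on $\mathbf{x}$ with no complementary pair, identified with their conjunction. Unit resolution derives $C\setminus\{l\}$ from a clause $C\ni l$ and the unit clause $\neg l$; $\vdash_1$ denotes derivability by repeated unit resolution; $\bot$ is the empty clause. For a set of literals $\alpha$, $\mathrm{cl}_{\mathrm{up}}(\varphi,\alpha)=\{l \text{ literal on }\mathbf{x}\mid \varphi\wedge\alpha\vdash_1 l\text{ or }\varphi\wedge\alpha\vdash_1\bot\}$. Implicational dual rail encoding: introduce a meta-variable $\ell_l$ for each literal $l$ on $\mathbf{x}$; $\mathrm{DR}(\varphi)$ is the CNF on these meta-variables consisting of the clause $\ell_l\vee\bigvee_{e\in C\setminus\{l\}}\neg\ell_{\neg e}$ for every pair $(C,l)$ with $l\in C\in\varphi$, and the consistency clauses $\neg\ell_x\vee\neg\ell_{\neg x}$ for every $x\in\mathbf{x}$. An assignment of the meta-variables is the characteristic function of the set of literals $\{l\mid \ell_l=1\}$. -}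

module Defs where

open import Data.Nat using (ℕ)
open import Data.Fin using (Fin)
open import Data.Fin.Properties using () renaming (_≟_ to _≟F_)
open import Data.Bool using (Bool; true; false; not)
open import Data.List using (List; []; _∷_; _++_; map; concatMap; filter)
open import Data.List.Membership.Propositional using (_∈_)
open import Data.List.Relation.Unary.All using (All)
open import Data.List.Relation.Unary.Any using (Any)
open import Data.Fin using (Fin)
open import Data.List using (allFin)
open import Data.Product using (_×_; ∃)
open import Data.Sum using (_⊎_)
open import Relation.Nullary using (¬_; Dec; yes; no)
open import Relation.Nullary.Decidable using (¬?)
open import Relation.Binary.PropositionalEquality using (_≡_; _≢_; refl; cong)
open import Relation.Binary.Definitions using (DecidableEquality)

data Lit (V : Set) : Set where
  pos : V → Lit V
  neg : V → Lit V

compl : {V : Set} → Lit V → Lit V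
compl (pos x) = neg x
compl (neg x) = pos x

-- a clause is a (finite) disjunction of literals, read as a set
Clause : Set → Set
Clause V = List (Lit V)

CNF : Set → Set
CNF V = List (Clause V)

Assignment : Set → Set
Assignment V = V → Bool

litVal : {V : Set} → Assignment V → Lit V → Bool
litVal a (pos x) = a x
litVal a (neg x) = not (a x)

_⊨_ : {V : Set} → Assignment V → CNF V → Set
a ⊨ φ = All (λ C → Any (λ l → litVal a l ≡ true) C) φ

_≟L_ : {n : ℕ} → DecidableEquality (Lit (Fin n))
pos x ≟L pos y with x ≟F y
... | yes refl = yes refl
... | no x≢y = no λ { refl → x≢y refl }
pos x ≟L neg y = no λ ()
neg x ≟L pos y = no λ ()
neg x ≟L neg y with x ≟F y
... | yes refl = yes refl
... | no x≢y = no λ { refl → x≢y refl }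

remove : {n : ℕ} → Lit (Fin n) → Clause (Fin n) → Clause (Fin n)
remove l C = filter (λ e → ¬? (e ≟L l)) C

-- A set of literals on x is represented by its characteristic function
-- Lit (Fin n) → Bool (this is exactly an assignment of the meta-variables ℓ_l).
LitSet : ℕ → Set
LitSet n = Lit (Fin n) → Bool

_∈ₛ_ : {n : ℕ} → Lit (Fin n) → LitSet n → Set
l ∈ₛ α = α l ≡ true

IsPartialAssignment : {n : ℕ} → LitSet n → Set
IsPartialAssignment {n} α = (x : Fin n) → ¬ (pos x ∈ₛ α × neg x ∈ₛ α)

-- D is (as a set) the unit clause {l}
IsUnit : {n : ℕ} → Clause (Fin n) → Lit (Fin n) → Set
IsUnit D l = (l ∈ D) × All (λ e → e ≡ l) D

-- Derivability by repeated unit resolution from φ ∧ α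
-- (α contributes the unit clauses l for l ∈ α).
data Derivable {n : ℕ} (φ : CNF (Fin n)) (α : LitSet n) : Clause (Fin n) → Set where
  axiom : {C : Clause (Fin n)} → C ∈ φ → Derivable φ α C
  unit  : {l : Lit (Fin n)} → l ∈ₛ α → Derivable φ α (l ∷ [])
  res   : {C D : Clause (Fin n)} {l : Lit (Fin n)} →
          Derivable φ α C → l ∈ C →
          Derivable φ α D → IsUnit D (compl l) →
          Derivable φ α (remove l C)

⊢₁lit : {n : ℕ} → CNF (Fin n) → LitSet n → Lit (Fin n) → Set
⊢₁lit φ α l = ∃ λ D → Derivable φ α D × IsUnit D l

⊢₁⊥ : {n : ℕ} → CNF (Fin n) → LitSet n → Set
⊢₁⊥ φ α = Derivable φ α []

_∈clup_,_ : {n : ℕ} → Lit (Fin n) → CNF (Fin n) → LitSet n → Set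
l ∈clup φ , α = ⊢₁lit φ α l ⊎ ⊢₁⊥ φ α

DRclause : {n : ℕ} → Clause (Fin n) → Lit (Fin n) → Clause (Lit (Fin n))
DRclause C l = pos l ∷ map (λ e → neg (compl e)) (remove l C)

DR : {n : ℕ} → CNF (Fin n) → CNF (Lit (Fin n))
DR {n} φ = concatMap (λ C → map (DRclause C) C) φ
        ++ map (λ x → neg (pos x) ∷ neg (neg x) ∷ []) (allFin n)

-- A model of DR(φ) is the characteristic function of a consistent set of literals α that is
-- unit-closed for every clause C of φ: whenever α falsifies all literals of C but l, then
-- l ∈ α. Unit resolution from φ ∧ α only derives clauses that are again unit-closed and not
-- falsified by α (for the clauses of φ this is where [] ∉ φ is needed), so every derived unit
-- lies in α and ⊥ is never derived. Conversely, if α is a fixpoint of cl_up and α falsifies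
-- C ∖ {l}, resolving C against the units ¬e ∈ α derives the unit l, so l ∈ α.
module Submission where

open import Defs
open import Data.Nat using (ℕ)
open import Data.Fin using (Fin)
open import Data.Bool using (Bool; true; false; not; _≟_)
open import Data.List using (List; []; _∷_)
open import Data.List.Membership.Propositional using (_∈_; _∉_)
open import Data.List.Membership.Propositional.Properties using (∈-filter⁺; ∈-filter⁻)
import Data.List.Membership.DecPropositional as DecMembership
open import Data.List.Properties using (filter-all)
open import Data.List.Relation.Binary.Subset.Propositional using (_⊆_)
open import Data.List.Relation.Unary.All as All using (All; []; _∷_)
open import Data.List.Relation.Unary.All.Properties
  using ( ¬All⇒Any¬; Any¬⇒¬All; ++⁺; ++⁻; concat⁺; concat⁻; filter⁺; map⁺; map⁻
        ; tabulate⁺; tabulate⁻)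
open import Data.List.Relation.Unary.Any as Any using (Any; here; there)
import Data.List.Relation.Unary.Any.Properties as Any
open import Data.Product using (_×_; _,_; proj₁; proj₂)
open import Data.Sum using (inj₁; inj₂)
open import Data.Empty using (⊥; ⊥-elim)
open import Function using (_∘_)
open import Function.Bundles using (_⇔_; mk⇔; Equivalence)
open import Relation.Nullary using (¬_; Dec; yes; no)
open import Relation.Nullary.Decidable using (¬?)
open import Relation.Binary.PropositionalEquality using (_≡_; _≢_; refl; sym; subst)

open Equivalence using (to; from)

not≡true⇔≢true : ∀ {b} → not b ≡ true ⇔ (b ≢ true)
not≡true⇔≢true {false} = mk⇔ (λ _ ()) (λ _ → refl)
not≡true⇔≢true {true}  = mk⇔ (λ ()) (λ b≢true → ⊥-elim (b≢true refl))

any-not⇔¬all : ∀ {A : Set} (a : A → Bool) (xs : List A) →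
  Any (λ x → not (a x) ≡ true) xs ⇔ (¬ All (λ x → a x ≡ true) xs)
any-not⇔¬all a xs = mk⇔
  (Any¬⇒¬All ∘ Any.map (to not≡true⇔≢true))
  (Any.map (from not≡true⇔≢true) ∘ ¬All⇒Any¬ (λ x → a x ≟ true) xs)

_⊨ᶜ_ : {V : Set} → Assignment V → Clause V → Set
a ⊨ᶜ C = Any (λ l → litVal a l ≡ true) C

module _ {n : ℕ} where

  open DecMembership (_≟L_ {n}) using (_∈?_)

  ∈-remove⁺ : ∀ {e l : Lit (Fin n)} {C} → e ∈ C → e ≢ l → e ∈ remove l C
  ∈-remove⁺ {l = l} = ∈-filter⁺ (λ e → ¬? (e ≟L l))

  ∈-remove⁻ : ∀ {e} (l : Lit (Fin n)) C → e ∈ remove l C → e ∈ C × e ≢ l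
  ∈-remove⁻ l C = ∈-filter⁻ (λ e → ¬? (e ≟L l)) {xs = C}

  remove-∉ : ∀ {l : Lit (Fin n)} {C} → l ∉ C → remove l C ≡ C
  remove-∉ {l} l∉C =
    filter-all (λ e → ¬? (e ≟L l)) (All.tabulate λ { e∈C refl → l∉C e∈C })

  module _ (m : LitSet n) where

    Falsifies : Clause (Fin n) → Set
    Falsifies D = All (λ e → compl e ∈ₛ m) D

    UnitClosed : Clause (Fin n) → Set
    UnitClosed C = ∀ {l} → l ∈ C → Falsifies (remove l C) → l ∈ₛ m

    partial-compl : IsPartialAssignment m → ∀ {l} → l ∈ₛ m → compl l ∈ₛ m → ⊥
    partial-compl pa {pos x} p q = pa x (p , q)
    partial-compl pa {neg x} p q = pa x (q , p)

    unitClosed-unit : ∀ {D l} → UnitClosed D → IsUnit D l → l ∈ₛ m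
    unitClosed-unit {D} closed (l∈D , allD) = closed l∈D (All.tabulate λ e∈ →
      let e∈D , e≢l = ∈-remove⁻ _ D e∈ in ⊥-elim (e≢l (All.lookup allD e∈D)))

    unitClosed-nonempty-¬falsified : IsPartialAssignment m →
      ∀ {C} → UnitClosed C → C ≢ [] → ¬ Falsifies C
    unitClosed-nonempty-¬falsified pa {[]}    _      C≢[] _ = C≢[] refl
    unitClosed-nonempty-¬falsified pa {l ∷ C} closed _    F =
      partial-compl pa (closed (here refl) (filter⁺ (λ e → ¬? (e ≟L l)) F)) (All.head F)

    resolvent-unitClosed : ∀ {C l} → UnitClosed C → compl l ∈ₛ m → UnitClosed (remove l C)
    resolvent-unitClosed {C} {l} closed cl∈m {l′} l′∈ F =
      closed (proj₁ (∈-remove⁻ l C l′∈)) (All.tabulate falsified)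
      where
      falsified : ∀ {e} → e ∈ remove l′ C → compl e ∈ₛ m
      falsified {e} e∈ with e ≟L l
      ... | yes refl = cl∈m
      ... | no e≢l   = let e∈C , e≢l′ = ∈-remove⁻ l′ C e∈ in
                       All.lookup F (∈-remove⁺ (∈-remove⁺ e∈C e≢l) e≢l′)

    ⊨ᶜ-DRclause⇔ : ∀ {C l} → m ⊨ᶜ DRclause C l ⇔ (Falsifies (remove l C) → l ∈ₛ m)
    ⊨ᶜ-DRclause⇔ {C} {l} = mk⇔
      (λ { (here l∈m) _ → l∈m
         ; (there sat) F → ⊥-elim (to tail⇔ (Any.map⁻ sat) F) })
      (λ closed → by-cases closed (All.all? (λ e → m (compl e) ≟ true) (remove l C)))
      where
      tail⇔ : Any (λ e → not (m (compl e)) ≡ true) (remove l C) ⇔ (¬ Falsifies (remove l C))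
      tail⇔ = any-not⇔¬all (m ∘ compl) (remove l C)

      by-cases : (Falsifies (remove l C) → l ∈ₛ m) → Dec (Falsifies (remove l C)) →
        m ⊨ᶜ DRclause C l
      by-cases closed (yes F)  = here (closed F)
      by-cases closed (no ¬F) = there (Any.map⁺ (from tail⇔ ¬F))

    ⊨ᶜ-consistency⇔ : ∀ x →
      m ⊨ᶜ (neg (pos x) ∷ neg (neg x) ∷ []) ⇔ (¬ (pos x ∈ₛ m × neg x ∈ₛ m))
    ⊨ᶜ-consistency⇔ x = mk⇔
      (λ sat (p , q) → to both⇔ (Any.map⁻ {f = neg} sat) (p ∷ q ∷ []))
      (λ ¬both → Any.map⁺ {f = neg} (from both⇔ λ { (p ∷ q ∷ []) → ¬both (p , q) }))
      where
      both⇔ : Any (λ v → not (m v) ≡ true) (pos x ∷ neg x ∷ []) ⇔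
        (¬ All (_∈ₛ m) (pos x ∷ neg x ∷ []))
      both⇔ = any-not⇔¬all m (pos x ∷ neg x ∷ [])

    ⊨DR⇔ : (φ : CNF (Fin n)) →
      (m ⊨ DR φ) ⇔ (IsPartialAssignment m × (∀ {C} → C ∈ φ → UnitClosed C))
    ⊨DR⇔ φ = mk⇔
      (λ sat → let satDR , satConsistency = ++⁻ _ sat in
        (λ x → to (⊨ᶜ-consistency⇔ x) (tabulate⁻ (map⁻ satConsistency) x)) ,
        (λ {C} C∈φ {l} l∈C → to (⊨ᶜ-DRclause⇔ {C} {l})
          (All.lookup (map⁻ (All.lookup (map⁻ (concat⁻ satDR)) C∈φ)) l∈C)))
      (λ (pa , closed) → ++⁺
        (concat⁺ (map⁺ (All.tabulate λ {C} C∈φ → map⁺ (All.tabulate λ {l} l∈C →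
          from (⊨ᶜ-DRclause⇔ {C} {l}) (closed C∈φ l∈C)))))
        (map⁺ (tabulate⁺ λ x → from (⊨ᶜ-consistency⇔ x) (pa x))))

  module _ (φ : CNF (Fin n)) (m : LitSet n) where

    derivable-sound : IsPartialAssignment m → [] ∉ φ → (∀ {C} → C ∈ φ → UnitClosed m C) →
      ∀ {D} → Derivable φ m D → UnitClosed m D × ¬ Falsifies m D
    derivable-sound pa []∉φ closed (axiom C∈φ) =
      closed C∈φ , unitClosed-nonempty-¬falsified m pa (closed C∈φ) λ { refl → []∉φ C∈φ }
    derivable-sound pa []∉φ closed (unit {l} l∈m) =
      unit-closed , unitClosed-nonempty-¬falsified m pa unit-closed λ ()
      where
      unit-closed : UnitClosed m (l ∷ [])
      unit-closed (here refl) _ = l∈m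
    derivable-sound pa []∉φ closed (res {C} {l = l} dC l∈C dD unitD) =
      resolvent-unitClosed m closedC cl∈m , λ F → partial-compl m pa (closedC l∈C F) cl∈m
      where
      closedC : UnitClosed m C
      closedC = proj₁ (derivable-sound pa []∉φ closed dC)

      cl∈m : compl l ∈ₛ m
      cl∈m = unitClosed-unit m (proj₁ (derivable-sound pa []∉φ closed dD)) unitD

    derivable-remove : ∀ {D k} → Derivable φ m D → compl k ∈ₛ m → Derivable φ m (remove k D)
    derivable-remove {D} {k} d ck with k ∈? D
    ... | yes k∈D = res d k∈D (unit ck) (here refl , refl ∷ [])
    ... | no k∉D  = subst (Derivable φ m) (sym (remove-∉ k∉D)) d

    derivable-unit : ∀ {D l} ks → Derivable φ m D → D ⊆ l ∷ ks → l ∈ D →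
      All (λ k → compl k ∈ₛ m × k ≢ l) ks → ⊢₁lit φ m l
    derivable-unit {D} []  d D⊆l l∈D [] = D , d , l∈D , All.tabulate (Any.singleton⁻ ∘ D⊆l)
    derivable-unit {D} {l} (k ∷ ks) d D⊆ l∈D ((ck , k≢l) ∷ hks) =
      derivable-unit ks (derivable-remove d ck) remove⊆ (∈-remove⁺ l∈D (k≢l ∘ sym)) hks
      where
      remove⊆ : remove k D ⊆ l ∷ ks
      remove⊆ e∈ with e∈D , e≢k ← ∈-remove⁻ k D e∈ with D⊆ e∈D
      ... | here e≡l           = here e≡l
      ... | there (here e≡k)   = ⊥-elim (e≢k e≡k)
      ... | there (there e∈ks) = there e∈ks

    clauses-unitClosed : (∀ l → l ∈clup φ , m → l ∈ₛ m) → ∀ {C} → C ∈ φ → UnitClosed m C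
    clauses-unitClosed fixed {C} C∈φ {l} l∈C F = fixed l (inj₁
      (derivable-unit (remove l C) (axiom C∈φ) C⊆ l∈C
        (All.tabulate λ k∈ → All.lookup F k∈ , proj₂ (∈-remove⁻ l C k∈))))
      where
      C⊆ : C ⊆ l ∷ remove l C
      C⊆ {e} e∈C with e ≟L l
      ... | yes e≡l = here e≡l
      ... | no e≢l  = there (∈-remove⁺ e∈C e≢l)

    clup-fixed : IsPartialAssignment m → [] ∉ φ → (∀ {C} → C ∈ φ → UnitClosed m C) →
      ∀ l → (l ∈clup φ , m) ⇔ (l ∈ₛ m)
    clup-fixed pa []∉φ closed l = mk⇔
      (λ { (inj₁ (_ , d , unitD)) → unitClosed-unit m (proj₁ (sound d)) unitD
         ; (inj₂ d) → ⊥-elim (proj₂ (sound d) []) })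
      (λ l∈m → inj₁ (l ∷ [] , unit l∈m , here refl , refl ∷ []))
      where
      sound : ∀ {D} → Derivable φ m D → UnitClosed m D × ¬ Falsifies m D
      sound = derivable-sound pa []∉φ closed

proposition4 : (n : ℕ) (φ : CNF (Fin n)) → [] ∉ φ →
    (m : LitSet n) →
    (m ⊨ DR φ) ⇔ (IsPartialAssignment m × (∀ l → (l ∈clup φ , m) ⇔ (l ∈ₛ m)))
proposition4 n φ []∉φ m = mk⇔
  (λ sat → let pa , closed = to (⊨DR⇔ m φ) sat in pa , clup-fixed φ m pa []∉φ closed)
  (λ (pa , fixed) → from (⊨DR⇔ m φ) (pa , clauses-unitClosed φ m (λ l → to (fixed l))))
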